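{- Let $m$ be an odd square-free positive integer and $p$ a prime with $\gcd(p,m)=1$; put $r=\mathrm{rem}(p,m)$, $q=\mathrm{quo}(p,m)$, and write $\Phi_m=\sum_{s\geq0}a_s x^s$. Write $G(x)=\Psi_m(x)\sum_{u\geq0}x^{um}=\sum_{t\geq0}e_t x^t\in\mathbb{Z}[[x]]$, and for $0\leq i\leq\varphi(m)-1$, $0\le j\le q$ define $g_{m,p,i,j}=\sum_{k=0}^{l}e_{ip+mj+k}x^k$, where $l=m-1$ if $j<q$ and $l=r-1$ if $j=q$. Then for all $0\leq i\leq\varphi(m)-1$ and $0\leq j\leq q$, \[ f_{m,p,i,j}=-\sum_{s=0}^{i}a_s\,g_{m,p,i-s,j}. \]
   Context: $\Phi_n$ is the $n$-th cyclotomic polynomial, $\varphi$ is Euler's totient, and $\Psi_m(x)=(x^m-1)/\Phi_m(x)$. For integers $a,b$ with $b>0$, $\mathrm{rem}(a,b)$ denotes the non-negative remainder and $\mathrm{quo}(a,b)$ the quotient. Blocks: write (uniquely) $\Phi_{mp}(x)=\sum_{i\geq0}f_{m,p,i}(x)\,x^{ip}$ with $\deg f_{m,p,i}<p$, and $f_{m,p,i}(x)=\sum_{j\geq0}f_{m,p,i,j}(x)\,x^{jm}$ with $\deg f_{m,p,i,j}<m$. -}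

module Defs where

open import Data.Bool using (Bool; true; false; if_then_else_)
open import Data.Nat as ℕ using (ℕ; zero; suc; _<?_; _≟_; NonZero)
open import Data.Nat.Divisibility using (_∣_; _∣?_)
open import Data.Nat.GCD using (gcd)
open import Data.Nat.DivMod using (_/_; _%_)
open import Data.List using (List; []; _∷_; length; filter; map; upTo)
open import Data.Integer using (ℤ; +_; _+_; _*_; -_; _-_)
open import Relation.Nullary.Decidable using (does)
open import Relation.Binary.PropositionalEquality using (_≡_)

-- Formal power series over ℤ, represented by their coefficient functions.
Series : Set
Series = ℕ → ℤ

sumTo : ℕ → (ℕ → ℤ) → ℤ
sumTo zero    f = f 0
sumTo (suc n) f = sumTo n f + f (suc n)

oneS : Series
oneS zero    = + 1
oneS (suc _) = + 0

mulS : Series → Series → Series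
mulS f g n = sumTo n (λ k → f k * g (n ℕ.∸ k))

xpowMinus1 : ℕ → Series
xpowMinus1 n k = (if does (k ≟ n) then + 1 else + 0) - (if does (k ≟ 0) then + 1 else + 0)

geomS : ℕ → Series
geomS m k = if does (m ∣? k) then + 1 else + 0

-- Inverse in ℤ[[x]] of a series whose constant term a₀ is a unit (±1, so a₀⁻¹ = a₀):
-- b₀ = a₀,  b_{n} = - a₀ · Σ_{k=1}^{n} a_k b_{n-k}.
-- invList a n = [b_n, b_{n-1}, …, b_0].
private
  convTail : Series → ℕ → List ℤ → ℤ
  convTail a t []       = + 0
  convTail a t (b ∷ bs) = a (suc t) * b + convTail a (suc t) bs

invList : Series → ℕ → List ℤ
invList a zero    = a 0 ∷ []
invList a (suc n) = (- (a 0 * convTail a 0 (invList a n))) ∷ invList a n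

headD : List ℤ → ℤ
headD []      = + 0
headD (x ∷ _) = x

invS : Series → Series
invS a n = headD (invList a n)

-- Cyclotomic polynomials (as series), via  Φ_n = (x^n - 1) / ∏_{d ∣ n, d < n} Φ_d.
-- cycTab n = [Φ_n, Φ_{n-1}, …, Φ_0]; convention Φ_0 = 1 (never used).
private
  prodDiv : ℕ → ℕ → List Series → Series
  prodDiv N d []       = oneS
  prodDiv N d (f ∷ fs) =
    if does (d ∣? N) then mulS f (prodDiv N (d ℕ.∸ 1) fs) else prodDiv N (d ℕ.∸ 1) fs

cycTab : ℕ → List Series
cycTab zero    = oneS ∷ []
cycTab (suc n) = mulS (xpowMinus1 (suc n)) (invS (prodDiv (suc n) n (cycTab n))) ∷ cycTab n

headS : List Series → Series
headS []      = oneS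
headS (f ∷ _) = f

cyclo : ℕ → Series
cyclo n = headS (cycTab n)

psi : ℕ → Series
psi m = mulS (xpowMinus1 m) (invS (cyclo m))

totient : ℕ → ℕ
totient m = length (filter (λ k → gcd k m ≟ 1) (map suc (upTo m)))

SquareFree : ℕ → Set
SquareFree m = ∀ d → (d ℕ.* d) ∣ m → d ≡ 1

-- Block f_{m,p,i}:  Φ_{mp} = Σ_i f_{m,p,i} x^{ip},  deg f_{m,p,i} < p
fBlock : ℕ → ℕ → ℕ → Series
fBlock m p i t = if does (t <? p) then cyclo (m ℕ.* p) (i ℕ.* p ℕ.+ t) else + 0

-- Block f_{m,p,i,j}:  f_{m,p,i} = Σ_j f_{m,p,i,j} x^{jm},  deg f_{m,p,i,j} < m
fBlock2 : ℕ → ℕ → ℕ → ℕ → Series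
fBlock2 m p i j k = if does (k <? m) then fBlock m p i (j ℕ.* m ℕ.+ k) else + 0

eCoeff : ℕ → Series
eCoeff m = mulS (psi m) (geomS m)

-- g_{m,p,i,j} = Σ_{k=0}^{l} e_{ip+mj+k} x^k, l = m-1 if j < q, l = r-1 if j = q
-- (coefficient k is present iff k < l+1, where l+1 = m if j < q, = r otherwise)
gBlock : (m p : ℕ) → .{{NonZero m}} → ℕ → ℕ → Series
gBlock m p i j k =
  if does (k <? (if does (j <? p / m) then m else p % m))
  then eCoeff m (i ℕ.* p ℕ.+ m ℕ.* j ℕ.+ k) else + 0

{-# OPTIONS --safe #-}
-- Since p is a prime not dividing m, the divisors of mp are the divisors e of m together
-- with their multiples ep.  Substituting x ↦ xᵖ in ∏_{e ∣ m} Φ_e = xᵐ − 1 and comparing with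
-- ∏_{d ∣ mp} Φ_d = xᵐᵖ − 1 gives, by strong induction over the divisors of m,
-- Φ_{mp}(x) Φ_m(x) = Φ_m(xᵖ).  Moreover G = Ψ_m/(1 − xᵐ) = −1/Φ_m, so Φ_{mp}(x) = −Φ_m(xᵖ) G(x),
-- whose coefficient of x^{ip+t} (t < p) is −Σ_{s ≤ i} a_s e_{(i−s)p+t}.  Writing t = jm + k
-- with k below the length of the j-th block gives the formula for f_{m,p,i,j}.
module Submission where

open import Defs
open import Algebra.Bundles using (CommutativeMonoid)
open import Algebra.Structures using (IsCommutativeMonoid)
open import Data.Bool using (Bool; true; false; if_then_else_; _∧_; not)
open import Data.Bool.Properties using (∧-zeroʳ; ∧-identityʳ)
open import Data.Empty using (⊥-elim)
open import Data.Integer as ℤ using (ℤ; +_; _+_; _*_; -_; _-_)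
import Data.Integer.Properties as ℤ
open import Data.Integer.Solver using (module +-*-Solver)
open import Data.List using (List; _∷_)
open import Data.Nat as ℕ using (ℕ; zero; suc; _∸_; _≤_; _<_; z≤n; s≤s; _≟_; _≤?_; _<?_; NonZero)
open import Data.Nat.Coprimality using (Coprime; coprime-divisor)
open import Data.Nat.Divisibility
  using ( _∣_; _∣?_; _∣0; ∣-refl; ∣-trans; divides; ∣⇒≤; ∣m+n∣m⇒∣n; ∣m∸n∣n⇒∣m; n∣m*n; m∣m*n
        ; *-monoˡ-∣; *-cancelʳ-∣)
open import Data.Nat.DivMod
  using ( _/_; _%_; m≡m%n+[m/n]*n; m%n<n; [m+kn]%n≡m%n; m<n⇒m%n≡m; +-distrib-/-∣ˡ; m*n/n≡m
        ; m<n⇒m/n≡0; m*n%n≡0)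
open import Data.Nat.Induction using (<-rec)
open import Data.Nat.Primality using (Prime; ¬prime[0]; ¬prime[1]; prime⇒irreducible)
import Data.Nat.Properties as ℕ
open import Data.Product using (_,_; _×_; proj₂)
open import Data.Sum using (inj₁; inj₂)
open import Function using (_∘_; mk⇔)
open import Level using (0ℓ)
open import Relation.Binary.Bundles using (Setoid)
open import Relation.Binary.PropositionalEquality
import Relation.Binary.Reasoning.Setoid
open import Relation.Binary.Structures using (IsEquivalence)
open import Relation.Nullary using (¬_; Dec; yes; no)
open import Relation.Nullary.Decidable using (does; dec-true; dec-false; does-⇔)

open +-*-Solver using (solve; _:+_; _:*_; :-_; _:-_; _:=_; con)

does≡true⇒ : ∀ {A : Set} (a? : Dec A) → does a? ≡ true → A
does≡true⇒ (yes a) _ = a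

if-yes : ∀ {A : Set} {X : Set} (a? : Dec A) {x y : X} → A → (if does a? then x else y) ≡ x
if-yes a? a rewrite dec-true a? a = refl

if-no : ∀ {A : Set} {X : Set} (a? : Dec A) {x y : X} → ¬ A → (if does a? then x else y) ≡ y
if-no a? ¬a rewrite dec-false a? ¬a = refl

sumTo-cong : ∀ n {f g : ℕ → ℤ} → (∀ k → k ≤ n → f k ≡ g k) → sumTo n f ≡ sumTo n g
sumTo-cong zero    f≗g = f≗g 0 z≤n
sumTo-cong (suc n) f≗g =
  cong₂ _+_ (sumTo-cong n (λ k k≤n → f≗g k (ℕ.m≤n⇒m≤1+n k≤n))) (f≗g (suc n) ℕ.≤-refl)

sumTo-distrib-+ : ∀ n (f g : ℕ → ℤ) → sumTo n (λ k → f k + g k) ≡ sumTo n f + sumTo n g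
sumTo-distrib-+ zero    f g = refl
sumTo-distrib-+ (suc n) f g =
  trans (cong (_+ (f (suc n) + g (suc n))) (sumTo-distrib-+ n f g))
        (interchange (sumTo n f) (sumTo n g) (f (suc n)) (g (suc n)))
  where
  interchange : ∀ a b c d → a + b + (c + d) ≡ a + c + (b + d)
  interchange = solve 4 (λ a b c d → a :+ b :+ (c :+ d) := a :+ c :+ (b :+ d)) refl

*-distribˡ-sumTo : ∀ n c (f : ℕ → ℤ) → c * sumTo n f ≡ sumTo n (λ k → c * f k)
*-distribˡ-sumTo zero    c f = refl
*-distribˡ-sumTo (suc n) c f =
  trans (ℤ.*-distribˡ-+ c (sumTo n f) (f (suc n))) (cong (_+ c * f (suc n)) (*-distribˡ-sumTo n c f))

neg-distrib-sumTo : ∀ n (f : ℕ → ℤ) → - sumTo n f ≡ sumTo n (λ k → - f k)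
neg-distrib-sumTo zero    f = refl
neg-distrib-sumTo (suc n) f =
  trans (ℤ.neg-distrib-+ (sumTo n f) (f (suc n))) (cong (_+ - f (suc n)) (neg-distrib-sumTo n f))

sumTo-zero : ∀ n (f : ℕ → ℤ) → (∀ k → k ≤ n → f k ≡ + 0) → sumTo n f ≡ + 0
sumTo-zero zero    f f≡0 = f≡0 0 z≤n
sumTo-zero (suc n) f f≡0 =
  cong₂ _+_ (sumTo-zero n f (λ k k≤n → f≡0 k (ℕ.m≤n⇒m≤1+n k≤n))) (f≡0 (suc n) ℕ.≤-refl)

sumTo-unfoldˡ : ∀ n (f : ℕ → ℤ) → sumTo (suc n) f ≡ f 0 + sumTo n (f ∘ suc)
sumTo-unfoldˡ zero    f = refl
sumTo-unfoldˡ (suc n) f =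
  trans (cong (_+ f (suc (suc n))) (sumTo-unfoldˡ n f)) (ℤ.+-assoc (f 0) (sumTo n (f ∘ suc)) _)

sumTo-reverse : ∀ n (f : ℕ → ℤ) → sumTo n f ≡ sumTo n (λ k → f (n ∸ k))
sumTo-reverse zero    f = refl
sumTo-reverse (suc n) f = begin
  sumTo (suc n) f
    ≡⟨ sumTo-unfoldˡ n f ⟩
  f 0 + sumTo n (f ∘ suc)
    ≡⟨ cong (λ z → f 0 + z) (sumTo-reverse n (f ∘ suc)) ⟩
  f 0 + sumTo n (λ k → f (suc (n ∸ k)))
    ≡⟨ cong (λ z → f 0 + z) (sumTo-cong n (λ k k≤n → cong f (sym (ℕ.+-∸-assoc 1 k≤n)))) ⟩
  f 0 + sumTo n (λ k → f (suc n ∸ k))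
    ≡⟨ ℤ.+-comm (f 0) _ ⟩
  sumTo n (λ k → f (suc n ∸ k)) + f 0
    ≡⟨ cong (λ z → sumTo n (λ k → f (suc n ∸ k)) + f z) (sym (ℕ.n∸n≡0 n)) ⟩
  sumTo (suc n) (λ k → f (suc n ∸ k)) ∎
  where open ≡-Reasoning

sumTo-pad : ∀ c d (h : ℕ → ℤ) → (∀ e → 0 < e → e ≤ d → h (c ℕ.+ e) ≡ + 0) →
            sumTo (c ℕ.+ d) h ≡ sumTo c h
sumTo-pad c zero    h h≡0 = cong (λ w → sumTo w h) (ℕ.+-identityʳ c)
sumTo-pad c (suc d) h h≡0 = begin
  sumTo (c ℕ.+ suc d) h
    ≡⟨ cong (λ w → sumTo w h) (ℕ.+-suc c d) ⟩
  sumTo (c ℕ.+ d) h + h (suc c ℕ.+ d)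
    ≡⟨ cong₂ _+_ (sumTo-pad c d h (λ e 0<e e≤d → h≡0 e 0<e (ℕ.m≤n⇒m≤1+n e≤d)))
                 (trans (cong h (sym (ℕ.+-suc c d))) (h≡0 (suc d) (s≤s z≤n) ℕ.≤-refl)) ⟩
  sumTo c h + + 0
    ≡⟨ ℤ.+-identityʳ _ ⟩
  sumTo c h ∎
  where open ≡-Reasoning

sumTo-last : ∀ a (f : ℕ → ℤ) → (∀ k → k < a → f k ≡ + 0) → sumTo a f ≡ f a
sumTo-last zero    f f≡0 = refl
sumTo-last (suc a) f f≡0 =
  trans (cong (_+ f (suc a)) (sumTo-zero a f (λ k k≤a → f≡0 k (s≤s k≤a)))) (ℤ.+-identityˡ _)

sumTo-single : ∀ n a (f : ℕ → ℤ) → (∀ k → k ≢ a → f k ≡ + 0) → a ≤ n → sumTo n f ≡ f a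
sumTo-single n a f f≡0 a≤n = begin
  sumTo n f               ≡⟨ cong (λ w → sumTo w f) (sym (ℕ.m+[n∸m]≡n a≤n)) ⟩
  sumTo (a ℕ.+ (n ∸ a)) f ≡⟨ sumTo-pad a (n ∸ a) f (λ { (suc e) _ _ → f≡0 _ (ℕ.m+1+n≢m a) }) ⟩
  sumTo a f               ≡⟨ sumTo-last a f (λ k k<a → f≡0 k (ℕ.<⇒≢ k<a)) ⟩
  f a                     ∎
  where open ≡-Reasoning

-- A record rather than a Π-type, so that f and g can be inferred from a proof of f ≈ g.
infix 4 _≈_
record _≈_ (f g : Series) : Set where
  constructor mk≈
  field coeff : ∀ n → f n ≡ g n
open _≈_ public

≈-isEquivalence : IsEquivalence _≈_
≈-isEquivalence = record
  { refl  = mk≈ (λ _ → refl)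
  ; sym   = λ f≈g → mk≈ (λ n → sym (coeff f≈g n))
  ; trans = λ f≈g g≈h → mk≈ (λ n → trans (coeff f≈g n) (coeff g≈h n))
  }

≈-setoid : Setoid 0ℓ 0ℓ
≈-setoid = record { isEquivalence = ≈-isEquivalence }

open IsEquivalence ≈-isEquivalence public using () renaming (refl to ≈-refl; sym to ≈-sym; trans to ≈-trans)
module ≈-Reasoning = Relation.Binary.Reasoning.Setoid ≈-setoid

negS : Series → Series
negS f n = - f n

negS-cong : ∀ {f g} → f ≈ g → negS f ≈ negS g
negS-cong f≈g = mk≈ λ n → cong -_ (coeff f≈g n)

negS-involutive : ∀ f → negS (negS f) ≈ f
negS-involutive f = mk≈ λ n → ℤ.neg-involutive (f n)

tailS : Series → Series
tailS f n = f (suc n)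

mulS-suc : ∀ f g n → mulS f g (suc n) ≡ f 0 * g (suc n) + mulS (tailS f) g n
mulS-suc f g n = sumTo-unfoldˡ n (λ k → f k * g (suc n ∸ k))

mulS-cong : ∀ {f f' g g'} → f ≈ f' → g ≈ g' → mulS f g ≈ mulS f' g'
mulS-cong f≈f' g≈g' = mk≈ λ n → sumTo-cong n (λ k _ → cong₂ _*_ (coeff f≈f' k) (coeff g≈g' (n ∸ k)))

mulS-congˡ : ∀ f {g g'} → g ≈ g' → mulS f g ≈ mulS f g'
mulS-congˡ f = mulS-cong (≈-refl {f})

mulS-congʳ : ∀ {f f'} g → f ≈ f' → mulS f g ≈ mulS f' g
mulS-congʳ g f≈f' = mulS-cong f≈f' (≈-refl {g})

mulS-comm : ∀ f g → mulS f g ≈ mulS g f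
mulS-comm f g = mk≈ λ n → trans (sumTo-reverse n _) (sumTo-cong n (λ k k≤n →
  trans (cong (λ z → f (n ∸ k) * g z) (ℕ.m∸[m∸n]≡n k≤n)) (ℤ.*-comm (f (n ∸ k)) (g k))))

mulS-identityˡ : ∀ f → mulS oneS f ≈ f
mulS-identityˡ f = mk≈ λ
  { zero    → ℤ.*-identityˡ (f 0)
  ; (suc n) → trans (mulS-suc oneS f n)
                    (trans (cong₂ _+_ (ℤ.*-identityˡ (f (suc n))) (sumTo-zero n _ (λ k _ → refl)))
                           (ℤ.+-identityʳ _))
  }

mulS-negʳ : ∀ f g → mulS f (negS g) ≈ negS (mulS f g)
mulS-negʳ f g = mk≈ λ n →
  trans (sumTo-cong n (λ k _ → sym (ℤ.neg-distribʳ-* (f k) (g (n ∸ k))))) (sym (neg-distrib-sumTo n _))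

mulS-tailS-mulS : ∀ f g h n →
  mulS (tailS (mulS f g)) h n ≡ f 0 * mulS (tailS g) h n + mulS (mulS (tailS f) g) h n
mulS-tailS-mulS f g h n = begin
  mulS (tailS (mulS f g)) h n
    ≡⟨ sumTo-cong n (λ k _ → trans (cong (_* h (n ∸ k)) (mulS-suc f g k))
                                   (expand (f 0) (g (suc k)) (mulS (tailS f) g k) (h (n ∸ k)))) ⟩
  sumTo n (λ k → f 0 * (g (suc k) * h (n ∸ k)) + mulS (tailS f) g k * h (n ∸ k))
    ≡⟨ sumTo-distrib-+ n _ _ ⟩
  sumTo n (λ k → f 0 * (g (suc k) * h (n ∸ k))) + mulS (mulS (tailS f) g) h n
    ≡⟨ cong (_+ mulS (mulS (tailS f) g) h n) (sym (*-distribˡ-sumTo n (f 0) _)) ⟩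
  f 0 * mulS (tailS g) h n + mulS (mulS (tailS f) g) h n ∎
  where
  open ≡-Reasoning
  expand : ∀ a b c d → (a * b + c) * d ≡ a * (b * d) + c * d
  expand = solve 4 (λ a b c d → (a :* b :+ c) :* d := a :* (b :* d) :+ c :* d) refl

mulS-assoc : ∀ f g h → mulS (mulS f g) h ≈ mulS f (mulS g h)
mulS-assoc f g h = mk≈ (assoc-at f g h)
  where
  assoc-at : ∀ f g h n → mulS (mulS f g) h n ≡ mulS f (mulS g h) n
  assoc-at f g h zero    = ℤ.*-assoc (f 0) (g 0) (h 0)
  assoc-at f g h (suc n) = begin
    mulS (mulS f g) h (suc n)
      ≡⟨ mulS-suc (mulS f g) h n ⟩
    f 0 * g 0 * h (suc n) + mulS (tailS (mulS f g)) h n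
      ≡⟨ cong (λ z → f 0 * g 0 * h (suc n) + z) (mulS-tailS-mulS f g h n) ⟩
    f 0 * g 0 * h (suc n) + (f 0 * mulS (tailS g) h n + mulS (mulS (tailS f) g) h n)
      ≡⟨ cong (λ z → f 0 * g 0 * h (suc n) + (f 0 * mulS (tailS g) h n + z))
              (assoc-at (tailS f) g h n) ⟩
    f 0 * g 0 * h (suc n) + (f 0 * mulS (tailS g) h n + mulS (tailS f) (mulS g h) n)
      ≡⟨ regroup (f 0) (g 0) (h (suc n)) (mulS (tailS g) h n) (mulS (tailS f) (mulS g h) n) ⟩
    f 0 * (g 0 * h (suc n) + mulS (tailS g) h n) + mulS (tailS f) (mulS g h) n
      ≡⟨ cong (λ z → f 0 * z + mulS (tailS f) (mulS g h) n) (sym (mulS-suc g h n)) ⟩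
    f 0 * mulS g h (suc n) + mulS (tailS f) (mulS g h) n
      ≡⟨ sym (mulS-suc f (mulS g h) n) ⟩
    mulS f (mulS g h) (suc n) ∎
    where
    open ≡-Reasoning
    regroup : ∀ a b c d e → a * b * c + (a * d + e) ≡ a * (b * c + d) + e
    regroup = solve 5 (λ a b c d e → a :* b :* c :+ (a :* d :+ e) := a :* (b :* c :+ d) :+ e) refl

mulS-isCommutativeMonoid : IsCommutativeMonoid _≈_ mulS oneS
mulS-isCommutativeMonoid = record
  { isMonoid = record
    { isSemigroup = record
      { isMagma  = record { isEquivalence = ≈-isEquivalence ; ∙-cong = mulS-cong }
      ; assoc    = mulS-assoc
      }
    ; identity = mulS-identityˡ , λ f → ≈-trans (mulS-comm f oneS) (mulS-identityˡ f)
    }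
  ; comm     = mulS-comm
  }

mulS-commutativeMonoid : CommutativeMonoid 0ℓ 0ℓ
mulS-commutativeMonoid = record { isCommutativeMonoid = mulS-isCommutativeMonoid }

open IsCommutativeMonoid mulS-isCommutativeMonoid public
  using () renaming (identityʳ to mulS-identityʳ)
open import Algebra.Properties.CommutativeSemigroup
  (CommutativeMonoid.commutativeSemigroup mulS-commutativeMonoid)
  using (interchange; x∙yz≈y∙xz)

IsUnit : ℤ → Set
IsUnit z = z * z ≡ + 1

IsUnit-* : ∀ x y → IsUnit x → IsUnit y → IsUnit (x * y)
IsUnit-* x y x²≡1 y²≡1 = trans (rearrange x y) (cong₂ _*_ x²≡1 y²≡1)
  where
  rearrange : ∀ x y → x * y * (x * y) ≡ x * x * (y * y)
  rearrange = solve 2 (λ x y → x :* y :* (x :* y) := x :* x :* (y :* y)) refl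

-- Defs keeps the helper of invList private.  The 'with' makes the equation below a
-- pattern unification problem whose unique solution is that helper, so we can name it.
mutual
  convTail : Series → ℕ → List ℤ → ℤ
  convTail = _

  invList-suc : ∀ a n → invList a (suc n) ≡ (- (a 0 * convTail a 0 (invList a n))) ∷ invList a n
  invList-suc a n with invList a n | 0
  ... | bs | t = refl

convTail-invList : ∀ a t n →
  convTail a t (invList a n) ≡ sumTo n (λ k → a (suc (t ℕ.+ k)) * invS a (n ∸ k))
convTail-invList a t zero    =
  trans (ℤ.+-identityʳ _) (cong (λ z → a (suc z) * a 0) (sym (ℕ.+-identityʳ t)))
convTail-invList a t (suc n) = begin
  a (suc t) * invS a (suc n) + convTail a (suc t) (invList a n)
    ≡⟨ cong₂ _+_ (cong (λ z → a (suc z) * invS a (suc n)) (sym (ℕ.+-identityʳ t)))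
                 (convTail-invList a (suc t) n) ⟩
  a (suc (t ℕ.+ 0)) * invS a (suc n) + sumTo n (λ k → a (suc (suc t ℕ.+ k)) * invS a (n ∸ k))
    ≡⟨ cong (λ z → a (suc (t ℕ.+ 0)) * invS a (suc n) + z)
            (sumTo-cong n (λ k _ → cong (λ z → a (suc z) * invS a (n ∸ k)) (sym (ℕ.+-suc t k)))) ⟩
  a (suc (t ℕ.+ 0)) * invS a (suc n) + sumTo n (λ k → a (suc (t ℕ.+ suc k)) * invS a (n ∸ k))
    ≡⟨ sym (sumTo-unfoldˡ n (λ k → a (suc (t ℕ.+ k)) * invS a (suc n ∸ k))) ⟩
  sumTo (suc n) (λ k → a (suc (t ℕ.+ k)) * invS a (suc n ∸ k)) ∎
  where open ≡-Reasoning

invS-suc : ∀ a n → invS a (suc n) ≡ - (a 0 * mulS (tailS a) (invS a) n)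
invS-suc a n =
  trans (cong headD (invList-suc a n)) (cong (λ z → - (a 0 * z)) (convTail-invList a 0 n))

invS-inverseʳ : ∀ a → IsUnit (a 0) → mulS a (invS a) ≈ oneS
invS-inverseʳ a a₀²≡1 = mk≈ λ
  { zero    → a₀²≡1
  ; (suc n) → let S = mulS (tailS a) (invS a) n in begin
      mulS a (invS a) (suc n)                ≡⟨ mulS-suc a (invS a) n ⟩
      a 0 * invS a (suc n) + S               ≡⟨ cong (λ z → a 0 * z + S) (invS-suc a n) ⟩
      a 0 * (- (a 0 * S)) + S                ≡⟨ factor (a 0) S ⟩
      (+ 1 - a 0 * a 0) * S                  ≡⟨ cong (λ z → (+ 1 - z) * S) a₀²≡1 ⟩
      + 0                                    ∎
  }
  where
  open ≡-Reasoning
  factor : ∀ a s → a * (- (a * s)) + s ≡ (+ 1 - a * a) * s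
  factor = solve 2 (λ a s → a :* (:- (a :* s)) :+ s := (con (+ 1) :- a :* a) :* s) refl

mulS-cancelʳ : ∀ {f g} u → IsUnit (u 0) → mulS f u ≈ mulS g u → f ≈ g
mulS-cancelʳ {f} {g} u u₀²≡1 fu≈gu = begin
  f                        ≈⟨ ≈-sym (mulS-identityʳ f) ⟩
  mulS f oneS              ≈⟨ mulS-congˡ f (≈-sym (invS-inverseʳ u u₀²≡1)) ⟩
  mulS f (mulS u (invS u)) ≈⟨ ≈-sym (mulS-assoc f u (invS u)) ⟩
  mulS (mulS f u) (invS u) ≈⟨ mulS-congʳ (invS u) fu≈gu ⟩
  mulS (mulS g u) (invS u) ≈⟨ mulS-assoc g u (invS u) ⟩
  mulS g (mulS u (invS u)) ≈⟨ mulS-congˡ g (invS-inverseʳ u u₀²≡1) ⟩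
  mulS g oneS              ≈⟨ mulS-identityʳ g ⟩
  g                        ∎
  where open ≈-Reasoning

prodWhere : (ℕ → Bool) → (ℕ → Series) → ℕ → Series
prodWhere P f zero    = oneS
prodWhere P f (suc d) = if P (suc d) then mulS (f (suc d)) (prodWhere P f d) else prodWhere P f d

prodWhere-suc-true : ∀ P f d → P (suc d) ≡ true →
  prodWhere P f (suc d) ≈ mulS (f (suc d)) (prodWhere P f d)
prodWhere-suc-true P f d Pd rewrite Pd = ≈-refl

prodWhere-cong : ∀ P {f g} n → (∀ e → 0 < e → e ≤ n → P e ≡ true → f e ≈ g e) →
                 prodWhere P f n ≈ prodWhere P g n
prodWhere-cong P zero    f≈g = ≈-refl
prodWhere-cong P (suc d) f≈g with P (suc d) in Pd
... | true  = mulS-cong (f≈g (suc d) (s≤s z≤n) ℕ.≤-refl Pd)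
                        (prodWhere-cong P d (λ e 0<e e≤d → f≈g e 0<e (ℕ.m≤n⇒m≤1+n e≤d)))
... | false = prodWhere-cong P d (λ e 0<e e≤d → f≈g e 0<e (ℕ.m≤n⇒m≤1+n e≤d))

prodWhere-congᴾ : ∀ {P Q} f n → (∀ e → 0 < e → e ≤ n → P e ≡ Q e) →
                  prodWhere P f n ≈ prodWhere Q f n
prodWhere-congᴾ f zero    P≗Q = ≈-refl
prodWhere-congᴾ {P} {Q} f (suc d) P≗Q
  rewrite P≗Q (suc d) (s≤s z≤n) ℕ.≤-refl with Q (suc d)
... | true  = mulS-congˡ (f (suc d))
                         (prodWhere-congᴾ f d (λ e 0<e e≤d → P≗Q e 0<e (ℕ.m≤n⇒m≤1+n e≤d)))
... | false = prodWhere-congᴾ f d (λ e 0<e e≤d → P≗Q e 0<e (ℕ.m≤n⇒m≤1+n e≤d))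

prodWhere-pad : ∀ P f m k → (∀ e → m < e → e ≤ k ℕ.+ m → P e ≡ false) →
                prodWhere P f (k ℕ.+ m) ≈ prodWhere P f m
prodWhere-pad P f m zero    P≡false = ≈-refl
prodWhere-pad P f m (suc k) P≡false
  rewrite P≡false (suc k ℕ.+ m) (s≤s (ℕ.m≤n+m m k)) ℕ.≤-refl =
  prodWhere-pad P f m k (λ e m<e e≤k+m → P≡false e m<e (ℕ.m≤n⇒m≤1+n e≤k+m))

prodWhere-mulS : ∀ P f g n →
  prodWhere P (λ e → mulS (f e) (g e)) n ≈ mulS (prodWhere P f n) (prodWhere P g n)
prodWhere-mulS P f g zero    = ≈-sym (mulS-identityˡ oneS)
prodWhere-mulS P f g (suc d) with P (suc d)
... | true  = ≈-trans (mulS-congˡ (mulS (f (suc d)) (g (suc d))) (prodWhere-mulS P f g d))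
                      (interchange (f (suc d)) (g (suc d)) (prodWhere P f d) (prodWhere P g d))
... | false = prodWhere-mulS P f g d

prodWhere-split : ∀ (P Q : ℕ → Bool) f n →
  prodWhere P f n ≈ mulS (prodWhere (λ e → P e ∧ Q e) f n) (prodWhere (λ e → P e ∧ not (Q e)) f n)
prodWhere-split P Q f zero    = ≈-sym (mulS-identityˡ oneS)
prodWhere-split P Q f (suc d) with P (suc d) | Q (suc d)
... | false | _     = prodWhere-split P Q f d
... | true  | true  = ≈-trans (mulS-congˡ (f (suc d)) (prodWhere-split P Q f d))
  (≈-sym (mulS-assoc (f (suc d)) (prodWhere (λ e → P e ∧ Q e) f d) (prodWhere (λ e → P e ∧ not (Q e)) f d)))
... | true  | false = ≈-trans (mulS-congˡ (f (suc d)) (prodWhere-split P Q f d))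
  (x∙yz≈y∙xz (f (suc d)) (prodWhere (λ e → P e ∧ Q e) f d) (prodWhere (λ e → P e ∧ not (Q e)) f d))

prodWhere-unit : ∀ P f n → (∀ e → IsUnit (f e 0)) → IsUnit (prodWhere P f n 0)
prodWhere-unit P f zero    f-unit = refl
prodWhere-unit P f (suc d) f-unit with P (suc d)
... | true  = IsUnit-* (f (suc d) 0) (prodWhere P f d 0) (f-unit (suc d)) (prodWhere-unit P f d f-unit)
... | false = prodWhere-unit P f d f-unit

prodWhere-suc-cong : ∀ P f d {g} → prodWhere P f d ≈ g →
  prodWhere P f (suc d) ≈ (if P (suc d) then mulS (f (suc d)) g else g)
prodWhere-suc-cong P f d f≈g with P (suc d)
... | true  = mulS-congˡ (f (suc d)) f≈g
... | false = f≈g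

prodWhere-multiples : ∀ P f M p' → (∀ a t → 0 < t → t < suc p' → P (a ℕ.* suc p' ℕ.+ t) ≡ false) →
  prodWhere P f (M ℕ.* suc p') ≈ prodWhere (λ e → P (e ℕ.* suc p')) (λ e → f (e ℕ.* suc p')) M
prodWhere-multiples P f zero    p' P≡false = ≈-refl
prodWhere-multiples P f (suc M) p' P≡false =
  prodWhere-suc-cong P f (p' ℕ.+ M ℕ.* suc p')
    (≈-trans (prodWhere-pad P f (M ℕ.* suc p') p' P≡false-between)
             (prodWhere-multiples P f M p' P≡false))
  where
  P≡false-between : ∀ e → M ℕ.* suc p' < e → e ≤ p' ℕ.+ M ℕ.* suc p' → P e ≡ false
  P≡false-between e Mp<e e≤ = subst (λ z → P z ≡ false) (ℕ.m+[n∸m]≡n (ℕ.<⇒≤ Mp<e))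
    (P≡false M (e ∸ M ℕ.* suc p') (ℕ.m<n⇒0<n∸m Mp<e)
       (s≤s (subst (e ∸ M ℕ.* suc p' ≤_) (ℕ.m+n∸n≡m p' (M ℕ.* suc p'))
                   (ℕ.∸-monoˡ-≤ (M ℕ.* suc p') e≤))))

divides? : ℕ → ℕ → Bool
divides? N e = does (e ∣? N)

-- As for invList above, this recovers the private helper of cycTab.
mutual
  prodDiv : ℕ → ℕ → List Series → Series
  prodDiv = _

  cyclo-suc : ∀ n → cyclo (suc n) ≡ mulS (xpowMinus1 (suc n)) (invS (prodDiv (suc n) n (cycTab n)))
  cyclo-suc n with cycTab n | suc n
  ... | fs | N = refl

cycloDivisorProd : ℕ → ℕ → Series
cycloDivisorProd N d = prodDiv N d (cycTab d)

cycloDivisorProd≈prodWhere : ∀ N d →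
  cycloDivisorProd (suc N) d ≈ prodWhere (divides? (suc N)) cyclo d
cycloDivisorProd≈prodWhere N zero    = ≈-refl
cycloDivisorProd≈prodWhere N (suc d) =
  ≈-sym (prodWhere-suc-cong (divides? (suc N)) cyclo d (≈-sym (cycloDivisorProd≈prodWhere N d)))

cycloDivisorProd-unit : ∀ d N → IsUnit (cycloDivisorProd N d 0)
cycloDivisorProd-unit zero    N with does (0 ∣? N)
... | true  = refl
... | false = refl
cycloDivisorProd-unit (suc d) N with does (suc d ∣? N)
... | true  = IsUnit-* (cyclo (suc d) 0) (cycloDivisorProd N d 0)
                (IsUnit-* (- + 1) (cycloDivisorProd (suc d) d 0) refl (cycloDivisorProd-unit d (suc d)))
                (cycloDivisorProd-unit d N)
... | false = cycloDivisorProd-unit d N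

cyclo-unit : ∀ n → IsUnit (cyclo n 0)
cyclo-unit zero    = refl
cyclo-unit (suc n) =
  IsUnit-* (- + 1) (cycloDivisorProd (suc n) n 0) refl (cycloDivisorProd-unit n (suc n))

prod-cyclo-divisors : ∀ N → prodWhere (divides? (suc N)) cyclo (suc N) ≈ xpowMinus1 (suc N)
prod-cyclo-divisors N = begin
  prodWhere (divides? (suc N)) cyclo (suc N)
    ≈⟨ prodWhere-suc-true (divides? (suc N)) cyclo N (dec-true (suc N ∣? suc N) ∣-refl) ⟩
  mulS (cyclo (suc N)) (prodWhere (divides? (suc N)) cyclo N)
    ≈⟨ mulS-congˡ (cyclo (suc N)) (≈-sym (cycloDivisorProd≈prodWhere N N)) ⟩
  mulS (mulS X (invS D)) D
    ≈⟨ mulS-assoc X (invS D) D ⟩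
  mulS X (mulS (invS D) D)
    ≈⟨ mulS-congˡ X (≈-trans (mulS-comm (invS D) D)
                             (invS-inverseʳ D (cycloDivisorProd-unit N (suc N)))) ⟩
  mulS X oneS
    ≈⟨ mulS-identityʳ X ⟩
  X ∎
  where
  open ≈-Reasoning
  X = xpowMinus1 (suc N)
  D = cycloDivisorProd (suc N) N

module Dilation (p' : ℕ) where

  p : ℕ
  p = suc p'

  dilate : Series → Series
  dilate f n = if does (n % p ≟ 0) then f (n / p) else + 0

  %-residue : ∀ a t → t < p → (a ℕ.* p ℕ.+ t) % p ≡ t
  %-residue a t t<p =
    trans (cong (_% p) (ℕ.+-comm (a ℕ.* p) t)) (trans ([m+kn]%n≡m%n t a p) (m<n⇒m%n≡m t<p))

  /-residue : ∀ a t → t < p → (a ℕ.* p ℕ.+ t) / p ≡ a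
  /-residue a t t<p = trans (+-distrib-/-∣ˡ t (divides a refl))
    (trans (cong₂ ℕ._+_ (m*n/n≡m a p) (m<n⇒m/n≡0 t<p)) (ℕ.+-identityʳ a))

  dilate-coeff : ∀ f a t → t < p →
                 dilate f (a ℕ.* p ℕ.+ t) ≡ (if does (t ≟ 0) then f a else + 0)
  dilate-coeff f a t t<p rewrite %-residue a t t<p | /-residue a t t<p = refl

  dilate-coeff-multiple : ∀ f a → dilate f (a ℕ.* p) ≡ f a
  dilate-coeff-multiple f a =
    trans (cong (dilate f) (sym (ℕ.+-identityʳ (a ℕ.* p)))) (dilate-coeff f a 0 (s≤s z≤n))

  ≈-by-residues : ∀ {f g} → (∀ a t → t < p → f (a ℕ.* p ℕ.+ t) ≡ g (a ℕ.* p ℕ.+ t)) → f ≈ g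
  ≈-by-residues {f} {g} f≡g = mk≈ λ n →
    subst (λ z → f z ≡ g z) (sym (n≡[n/p]*p+n%p n)) (f≡g (n / p) (n % p) (m%n<n n p))
    where
    n≡[n/p]*p+n%p : ∀ n → n ≡ n / p ℕ.* p ℕ.+ n % p
    n≡[n/p]*p+n%p n = trans (m≡m%n+[m/n]*n n p) (ℕ.+-comm (n % p) _)

  sumTo-multiples : ∀ (h : ℕ → ℤ) → (∀ b u → 0 < u → u < p → h (b ℕ.* p ℕ.+ u) ≡ + 0) →
                    ∀ a t → t < p → sumTo (a ℕ.* p ℕ.+ t) h ≡ sumTo a (λ s → h (s ℕ.* p))
  sumTo-multiples h h≡0 a t t<p =
    trans (sumTo-pad (a ℕ.* p) t h (λ u 0<u u≤t → h≡0 a u 0<u (ℕ.≤-<-trans u≤t t<p))) (exact a)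
    where
    exact : ∀ a → sumTo (a ℕ.* p) h ≡ sumTo a (λ s → h (s ℕ.* p))
    exact zero    = refl
    exact (suc a) = cong (_+ h (suc a ℕ.* p))
      (trans (cong (λ w → sumTo w h) (ℕ.+-comm p' (a ℕ.* p)))
      (trans (sumTo-pad (a ℕ.* p) p' h (λ u 0<u u≤p' → h≡0 a u 0<u (s≤s u≤p'))) (exact a)))

  mulS-dilate-coeff : ∀ f g a t → t < p →
    mulS (dilate f) g (a ℕ.* p ℕ.+ t) ≡ sumTo a (λ s → f s * g ((a ∸ s) ℕ.* p ℕ.+ t))
  mulS-dilate-coeff f g a t t<p =
    trans (sumTo-multiples summand off-multiples a t t<p)
          (sumTo-cong a (λ s s≤a → cong₂ _*_ (dilate-coeff-multiple f s) (cong g (shift s s≤a))))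
    where
    summand : ℕ → ℤ
    summand k = dilate f k * g (a ℕ.* p ℕ.+ t ∸ k)
    off-multiples : ∀ b u → 0 < u → u < p → summand (b ℕ.* p ℕ.+ u) ≡ + 0
    off-multiples b u@(suc _) _ u<p =
      cong (_* g (a ℕ.* p ℕ.+ t ∸ (b ℕ.* p ℕ.+ u))) (dilate-coeff f b u u<p)
    shift : ∀ s → s ≤ a → a ℕ.* p ℕ.+ t ∸ s ℕ.* p ≡ (a ∸ s) ℕ.* p ℕ.+ t
    shift s s≤a =
      trans (ℕ.+-∸-comm t (ℕ.*-monoˡ-≤ p s≤a)) (cong (ℕ._+ t) (sym (ℕ.*-distribʳ-∸ p a s)))

  dilate-cong : ∀ {f g} → f ≈ g → dilate f ≈ dilate g
  dilate-cong f≈g = mk≈ λ n → cong (λ z → if does (n % p ≟ 0) then z else + 0) (coeff f≈g (n / p))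

  dilate-mulS : ∀ f g → dilate (mulS f g) ≈ mulS (dilate f) (dilate g)
  dilate-mulS f g = ≈-by-residues coeff-eq
    where
    coeff-eq : ∀ a t → t < p →
               dilate (mulS f g) (a ℕ.* p ℕ.+ t) ≡ mulS (dilate f) (dilate g) (a ℕ.* p ℕ.+ t)
    coeff-eq a zero    t<p = trans (dilate-coeff (mulS f g) a 0 t<p) (sym
      (trans (mulS-dilate-coeff f (dilate g) a 0 t<p)
             (sumTo-cong a (λ s _ → cong (f s *_) (dilate-coeff g (a ∸ s) 0 t<p)))))
    coeff-eq a (suc t) t<p = trans (dilate-coeff (mulS f g) a (suc t) t<p) (sym
      (trans (mulS-dilate-coeff f (dilate g) a (suc t) t<p)
             (sumTo-zero a _ (λ s _ → trans (cong (f s *_) (dilate-coeff g (a ∸ s) (suc t) t<p))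
                                            (ℤ.*-zeroʳ (f s))))))

  dilate-oneS : dilate oneS ≈ oneS
  dilate-oneS = ≈-by-residues coeff-eq
    where
    coeff-eq : ∀ a t → t < p → dilate oneS (a ℕ.* p ℕ.+ t) ≡ oneS (a ℕ.* p ℕ.+ t)
    coeff-eq zero    zero    t<p = refl
    coeff-eq (suc a) zero    t<p = dilate-coeff oneS (suc a) 0 t<p
    coeff-eq a       (suc t) t<p =
      trans (dilate-coeff oneS a (suc t) t<p) (sym (cong oneS (ℕ.+-suc (a ℕ.* p) t)))

  dilate-prodWhere : ∀ P f n → dilate (prodWhere P f n) ≈ prodWhere P (dilate ∘ f) n
  dilate-prodWhere P f zero    = dilate-oneS
  dilate-prodWhere P f (suc d) with P (suc d)
  ... | true  = ≈-trans (dilate-mulS (f (suc d)) (prodWhere P f d))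
                        (mulS-congˡ (dilate (f (suc d))) (dilate-prodWhere P f d))
  ... | false = dilate-prodWhere P f d

  dilate-xpowMinus1 : ∀ m → dilate (xpowMinus1 m) ≈ xpowMinus1 (m ℕ.* p)
  dilate-xpowMinus1 m = ≈-by-residues coeff-eq
    where
    indicator : Bool → ℤ
    indicator b = if b then + 1 else + 0
    scaled-≟ : ∀ a b → does (a ≟ b) ≡ does (a ℕ.* p ℕ.+ 0 ≟ b ℕ.* p)
    scaled-≟ a b = does-⇔ (mk⇔ (λ a≡b → trans (ℕ.+-identityʳ _) (cong (ℕ._* p) a≡b))
                               (λ ap≡bp → ℕ.*-cancelʳ-≡ a b p (trans (sym (ℕ.+-identityʳ _)) ap≡bp)))
                          (a ≟ b) (a ℕ.* p ℕ.+ 0 ≟ b ℕ.* p)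
    coeff-eq : ∀ a t → t < p →
               dilate (xpowMinus1 m) (a ℕ.* p ℕ.+ t) ≡ xpowMinus1 (m ℕ.* p) (a ℕ.* p ℕ.+ t)
    coeff-eq a zero t<p = trans (dilate-coeff (xpowMinus1 m) a 0 t<p)
      (cong₂ (λ x y → indicator x - indicator y) (scaled-≟ a m) (scaled-≟ a 0))
    coeff-eq a (suc t) t<p = trans (dilate-coeff (xpowMinus1 m) a (suc t) t<p)
      (sym (cong₂ (λ x y → indicator x - indicator y)
        (dec-false (a ℕ.* p ℕ.+ suc t ≟ m ℕ.* p)
          (λ eq → ℕ.1+n≢0 (trans (sym (%-residue a (suc t) t<p))
                                 (trans (cong (_% p) eq) (m*n%n≡0 m p)))))
        (dec-false (a ℕ.* p ℕ.+ suc t ≟ 0) (λ eq → ℕ.1+n≢0 (trans (sym (ℕ.+-suc (a ℕ.* p) t)) eq)))))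

monomial : ℕ → Series
monomial a k = if does (k ≟ a) then + 1 else + 0

mulS-monomial-≤ : ∀ a g n → a ≤ n → mulS (monomial a) g n ≡ g (n ∸ a)
mulS-monomial-≤ a g n a≤n = trans (sumTo-single n a _ off-a a≤n)
  (trans (cong (λ b → (if b then + 1 else + 0) * g (n ∸ a)) (dec-true (a ≟ a) refl))
         (ℤ.*-identityˡ (g (n ∸ a))))
  where
  off-a : ∀ k → k ≢ a → monomial a k * g (n ∸ k) ≡ + 0
  off-a k k≢a = cong (λ b → (if b then + 1 else + 0) * g (n ∸ k)) (dec-false (k ≟ a) k≢a)

mulS-monomial-> : ∀ a g n → n < a → mulS (monomial a) g n ≡ + 0
mulS-monomial-> a g n n<a = sumTo-zero n _ (λ k k≤n →
  cong (λ b → (if b then + 1 else + 0) * g (n ∸ k)) (dec-false (k ≟ a) (λ { refl → ℕ.<⇒≱ n<a k≤n })))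

mulS-xpowMinus1 : ∀ m g n → mulS (xpowMinus1 m) g n ≡ mulS (monomial m) g n - g n
mulS-xpowMinus1 m g n = begin
  mulS (xpowMinus1 m) g n
    ≡⟨ sumTo-cong n (λ k _ → split (monomial m k) (monomial 0 k) (g (n ∸ k))) ⟩
  sumTo n (λ k → monomial m k * g (n ∸ k) + - (monomial 0 k * g (n ∸ k)))
    ≡⟨ sumTo-distrib-+ n _ _ ⟩
  mulS (monomial m) g n + sumTo n (λ k → - (monomial 0 k * g (n ∸ k)))
    ≡⟨ cong (λ z → mulS (monomial m) g n + z) (sym (neg-distrib-sumTo n _)) ⟩
  mulS (monomial m) g n - mulS (monomial 0) g n
    ≡⟨ cong (λ z → mulS (monomial m) g n - z) (mulS-monomial-≤ 0 g n z≤n) ⟩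
  mulS (monomial m) g n - g n ∎
  where
  open ≡-Reasoning
  split : ∀ a b c → (a - b) * c ≡ a * c + - (b * c)
  split = solve 3 (λ a b c → (a :- b) :* c := a :* c :+ (:- (b :* c))) refl

xpowMinus1-mulS-geomS : ∀ m' → mulS (xpowMinus1 (suc m')) (geomS (suc m')) ≈ negS oneS
xpowMinus1-mulS-geomS m' = mk≈ λ n → trans (mulS-xpowMinus1 m (geomS m) n) (coeff-eq n)
  where
  m = suc m'
  coeff-eq : ∀ n → mulS (monomial m) (geomS m) n - geomS m n ≡ negS oneS n
  coeff-eq n with m ≤? n
  ... | no  m≰n = trans (cong (_- geomS m n) (mulS-monomial-> m (geomS m) n (ℕ.≰⇒> m≰n)))
                        (below n (ℕ.≰⇒> m≰n))
    where
    below : ∀ n → n < m → + 0 - geomS m n ≡ negS oneS n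
    below zero    _   = refl
    below (suc n) n<m =
      cong (λ b → + 0 - (if b then + 1 else + 0)) (dec-false (m ∣? suc n) (ℕ.<⇒≱ n<m ∘ ∣⇒≤))
  ... | yes m≤n = trans (cong (_- geomS m n) (mulS-monomial-≤ m (geomS m) n m≤n)) (above n m≤n)
    where
    above : ∀ n → m ≤ n → geomS m (n ∸ m) - geomS m n ≡ negS oneS n
    above (suc n) m≤n =
      trans (cong (λ b → (if b then + 1 else + 0) - geomS m (suc n))
                  (does-⇔ (mk⇔ (λ m∣n-m → ∣m∸n∣n⇒∣m m m≤n m∣n-m ∣-refl)
                               (λ m∣n → ∣m+n∣m⇒∣n (subst (m ∣_) (sym (ℕ.m+[n∸m]≡n m≤n)) m∣n)
                                                   ∣-refl))
                          (m ∣? suc n ∸ m) (m ∣? suc n)))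
            (ℤ.+-inverseʳ (geomS m (suc n)))

eCoeff≈neg-invS-cyclo : ∀ m' → eCoeff (suc m') ≈ negS (invS (cyclo (suc m')))
eCoeff≈neg-invS-cyclo m' = begin
  mulS (mulS (xpowMinus1 m) I) (geomS m) ≈⟨ mulS-congʳ (geomS m) (mulS-comm (xpowMinus1 m) I) ⟩
  mulS (mulS I (xpowMinus1 m)) (geomS m) ≈⟨ mulS-assoc I (xpowMinus1 m) (geomS m) ⟩
  mulS I (mulS (xpowMinus1 m) (geomS m)) ≈⟨ mulS-congˡ I (xpowMinus1-mulS-geomS m') ⟩
  mulS I (negS oneS)                     ≈⟨ mulS-negʳ I oneS ⟩
  negS (mulS I oneS)                     ≈⟨ negS-cong (mulS-identityʳ I) ⟩
  negS I                                 ∎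
  where
  open ≈-Reasoning
  m = suc m'
  I = invS (cyclo m)

blockLength : (m p : ℕ) → .{{NonZero m}} → ℕ → ℕ
blockLength m p j = if does (j <? p / m) then m else p % m

module _ (m p : ℕ) .{{_ : NonZero m}} where

  private
    p≡q*m+r : p ≡ p / m ℕ.* m ℕ.+ p % m
    p≡q*m+r = trans (m≡m%n+[m/n]*n p m) (ℕ.+-comm (p % m) _)

  <-blockLength⇒ : ∀ {j k} → j ≤ p / m → k < blockLength m p j → k < m × j ℕ.* m ℕ.+ k < p
  <-blockLength⇒ {j} {k} j≤q k<len with j <? p / m
  ... | yes j<q = k<m , (begin-strict
    j ℕ.* m ℕ.+ k         <⟨ ℕ.+-monoʳ-< (j ℕ.* m) k<m ⟩
    j ℕ.* m ℕ.+ m         ≡⟨ ℕ.+-comm (j ℕ.* m) m ⟩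
    suc j ℕ.* m           ≤⟨ ℕ.*-monoˡ-≤ m j<q ⟩
    p / m ℕ.* m           ≤⟨ ℕ.m≤m+n _ (p % m) ⟩
    p / m ℕ.* m ℕ.+ p % m ≡⟨ sym p≡q*m+r ⟩
    p                     ∎)
    where
    open ℕ.≤-Reasoning
    k<m = subst (k <_) (if-yes (j <? p / m) j<q) k<len
  ... | no  j≮q with ℕ.≤∧≮⇒≡ j≤q j≮q
  ...   | refl = ℕ.<-trans k<r (m%n<n p m) ,
                 subst (j ℕ.* m ℕ.+ k <_) (sym p≡q*m+r) (ℕ.+-monoʳ-< (j ℕ.* m) k<r)
    where k<r = subst (k <_) (if-no (j <? p / m) j≮q) k<len

  <-blockLength⇐ : ∀ {j k} → j ≤ p / m → k < m → j ℕ.* m ℕ.+ k < p → k < blockLength m p j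
  <-blockLength⇐ {j} {k} j≤q k<m jm+k<p with j <? p / m
  ... | yes j<q = subst (k <_) (sym (if-yes (j <? p / m) j<q)) k<m
  ... | no  j≮q with ℕ.≤∧≮⇒≡ j≤q j≮q
  ...   | refl = subst (k <_) (sym (if-no (j <? p / m) j≮q))
                   (ℕ.+-cancelˡ-< (j ℕ.* m) k (p % m) (subst (j ℕ.* m ℕ.+ k <_) p≡q*m+r jm+k<p))

  fBlock2-blockLength : ∀ i {j} k → j ≤ p / m →
    fBlock2 m p i j k ≡
    (if does (k <? blockLength m p j) then cyclo (m ℕ.* p) (i ℕ.* p ℕ.+ (j ℕ.* m ℕ.+ k)) else + 0)
  fBlock2-blockLength i {j} k j≤q with k <? blockLength m p j
  ... | yes k<len = let (k<m , jm+k<p) = <-blockLength⇒ j≤q k<len in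
    trans (if-yes (k <? m) k<m)
          (trans (if-yes (j ℕ.* m ℕ.+ k <? p) jm+k<p) (sym (if-yes (k <? blockLength m p j) k<len)))
  ... | no  k≮len = trans fBlock2≡0 (sym (if-no (k <? blockLength m p j) k≮len))
    where
    fBlock2≡0 : fBlock2 m p i j k ≡ + 0
    fBlock2≡0 with k <? m
    ... | no  k≮m = if-no (k <? m) k≮m
    ... | yes k<m =
      trans (if-yes (k <? m) k<m) (if-no (j ℕ.* m ℕ.+ k <? p) (k≮len ∘ <-blockLength⇐ j≤q k<m))

module CycloDilation (p' : ℕ) (p-prime : Prime (suc p')) where
  open Dilation p'

  coprime⇒∤ : ∀ {m} → Coprime p m → ¬ p ∣ m
  coprime⇒∤ p⊥m p∣m with p⊥m (∣-refl , p∣m)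
  ... | refl = ¬prime[1] p-prime

  ∤⇒coprime : ∀ {e} → ¬ p ∣ e → Coprime e p
  ∤⇒coprime p∤e (d∣e , d∣p) with prime⇒irreducible p-prime d∣p
  ... | inj₁ d≡1 = d≡1
  ... | inj₂ refl = ⊥-elim (p∤e d∣e)

  divisibleByP? : ℕ → Bool
  divisibleByP? e = does (p ∣? e)

  prod-cyclo-divisors-divisibleByP : ∀ m →
    prodWhere (λ e → divides? (m ℕ.* p) e ∧ divisibleByP? e) cyclo (m ℕ.* p) ≈
    prodWhere (divides? m) (λ e → cyclo (e ℕ.* p)) m
  prod-cyclo-divisors-divisibleByP m =
    ≈-trans (prodWhere-multiples _ cyclo m p' off-multiples) (prodWhere-congᴾ _ m same-predicate)
    where
    off-multiples : ∀ b u → 0 < u → u < p →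
                    divides? (m ℕ.* p) (b ℕ.* p ℕ.+ u) ∧ divisibleByP? (b ℕ.* p ℕ.+ u) ≡ false
    off-multiples b u 0<u u<p = trans (cong (divides? (m ℕ.* p) (b ℕ.* p ℕ.+ u) ∧_)
      (dec-false (p ∣? b ℕ.* p ℕ.+ u)
                 (λ p∣ → ℕ.<⇒≱ u<p (∣⇒≤ {{ℕ.>-nonZero 0<u}} (∣m+n∣m⇒∣n p∣ (n∣m*n b))))))
      (∧-zeroʳ _)
    same-predicate : ∀ e → 0 < e → e ≤ m →
                     divides? (m ℕ.* p) (e ℕ.* p) ∧ divisibleByP? (e ℕ.* p) ≡ divides? m e
    same-predicate e _ _ =
      trans (cong (divides? (m ℕ.* p) (e ℕ.* p) ∧_) (dec-true (p ∣? e ℕ.* p) (n∣m*n e)))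
            (trans (∧-identityʳ _)
                   (does-⇔ (mk⇔ (*-cancelʳ-∣ p) (*-monoˡ-∣ p)) (e ℕ.* p ∣? m ℕ.* p) (e ∣? m)))

  prod-cyclo-divisors-¬divisibleByP : ∀ m → Coprime p m →
    prodWhere (λ e → divides? (m ℕ.* p) e ∧ not (divisibleByP? e)) cyclo (m ℕ.* p) ≈
    prodWhere (divides? m) cyclo m
  prod-cyclo-divisors-¬divisibleByP zero       _   = ≈-refl
  prod-cyclo-divisors-¬divisibleByP m@(suc _) p⊥m = begin
    prodWhere (λ e → divides? (m ℕ.* p) e ∧ not (divisibleByP? e)) cyclo (m ℕ.* p)
      ≈⟨ prodWhere-congᴾ cyclo (m ℕ.* p) same-predicate ⟩
    prodWhere (divides? m) cyclo (m ℕ.* p)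
      ≡⟨ cong (prodWhere (divides? m) cyclo) (sym (ℕ.m∸n+n≡m (ℕ.m≤m*n m p))) ⟩
    prodWhere (divides? m) cyclo ((m ℕ.* p ∸ m) ℕ.+ m)
      ≈⟨ prodWhere-pad (divides? m) cyclo m (m ℕ.* p ∸ m)
                       (λ e m<e _ → dec-false (e ∣? m) (ℕ.<⇒≱ m<e ∘ ∣⇒≤)) ⟩
    prodWhere (divides? m) cyclo m ∎
    where
    open ≈-Reasoning
    same-predicate : ∀ e → 0 < e → e ≤ m ℕ.* p →
                     divides? (m ℕ.* p) e ∧ not (divisibleByP? e) ≡ divides? m e
    same-predicate e _ _ with e ∣? m
    ... | yes e∣m = cong₂ (λ x y → x ∧ not y) (dec-true (e ∣? m ℕ.* p) (∣-trans e∣m (m∣m*n p)))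
                                              (dec-false (p ∣? e) (λ p∣e → coprime⇒∤ p⊥m (∣-trans p∣e e∣m)))
    ... | no e∤m with e ∣? m ℕ.* p | p ∣? e
    ...   | no _    | _       = refl
    ...   | yes _   | yes p∣e = cong not (dec-true (p ∣? e) p∣e)
    ...   | yes e∣mp | no p∤e =
      ⊥-elim (e∤m (coprime-divisor (∤⇒coprime p∤e) (subst (e ∣_) (ℕ.*-comm m p) e∣mp)))

  prod-dilate-cyclo : ∀ m' → let m = suc m' in Coprime p m →
    prodWhere (divides? m) (dilate ∘ cyclo) m ≈
    prodWhere (divides? m) (λ e → mulS (cyclo (e ℕ.* p)) (cyclo e)) m
  prod-dilate-cyclo m' p⊥m = begin
    prodWhere (divides? m) (dilate ∘ cyclo) m
      ≈⟨ ≈-sym (dilate-prodWhere (divides? m) cyclo m) ⟩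
    dilate (prodWhere (divides? m) cyclo m)
      ≈⟨ dilate-cong (prod-cyclo-divisors m') ⟩
    dilate (xpowMinus1 m)
      ≈⟨ dilate-xpowMinus1 m ⟩
    xpowMinus1 (m ℕ.* p)
      ≈⟨ ≈-sym (prod-cyclo-divisors (p' ℕ.+ m' ℕ.* p)) ⟩
    prodWhere (divides? (m ℕ.* p)) cyclo (m ℕ.* p)
      ≈⟨ prodWhere-split (divides? (m ℕ.* p)) divisibleByP? cyclo (m ℕ.* p) ⟩
    mulS (prodWhere (λ e → divides? (m ℕ.* p) e ∧ divisibleByP? e) cyclo (m ℕ.* p))
         (prodWhere (λ e → divides? (m ℕ.* p) e ∧ not (divisibleByP? e)) cyclo (m ℕ.* p))
      ≈⟨ mulS-cong (prod-cyclo-divisors-divisibleByP m) (prod-cyclo-divisors-¬divisibleByP m p⊥m) ⟩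
    mulS (prodWhere (divides? m) (λ e → cyclo (e ℕ.* p)) m) (prodWhere (divides? m) cyclo m)
      ≈⟨ ≈-sym (prodWhere-mulS (divides? m) (λ e → cyclo (e ℕ.* p)) cyclo m) ⟩
    prodWhere (divides? m) (λ e → mulS (cyclo (e ℕ.* p)) (cyclo e)) m ∎
    where
    open ≈-Reasoning
    m = suc m'

  cyclo-mul-dilate : ∀ m → Coprime p m → mulS (cyclo (m ℕ.* p)) (cyclo m) ≈ dilate (cyclo m)
  cyclo-mul-dilate = <-rec (λ m → Coprime p m → mulS (cyclo (m ℕ.* p)) (cyclo m) ≈ dilate (cyclo m)) step
    where
    Φ[_p]Φ : ℕ → Series
    Φ[ e p]Φ = mulS (cyclo (e ℕ.* p)) (cyclo e)
    step : ∀ m → (∀ {e} → e < m → Coprime p e → Φ[ e p]Φ ≈ dilate (cyclo e)) →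
           Coprime p m → Φ[ m p]Φ ≈ dilate (cyclo m)
    step zero      _  p⊥0 = ⊥-elim (coprime⇒∤ p⊥0 (p ∣0))
    step m@(suc m') ih p⊥m = ≈-sym (mulS-cancelʳ V V-unit (begin
      mulS (dilate (cyclo m)) V
        ≈⟨ mulS-congˡ (dilate (cyclo m)) (prodWhere-cong (divides? m) m' ih-divisors) ⟩
      mulS (dilate (cyclo m)) (prodWhere (divides? m) (dilate ∘ cyclo) m')
        ≈⟨ ≈-sym (prodWhere-suc-true (divides? m) (dilate ∘ cyclo) m' m∣m) ⟩
      prodWhere (divides? m) (dilate ∘ cyclo) m
        ≈⟨ prod-dilate-cyclo m' p⊥m ⟩
      prodWhere (divides? m) Φ[_p]Φ m
        ≈⟨ prodWhere-suc-true (divides? m) Φ[_p]Φ m' m∣m ⟩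
      mulS Φ[ m p]Φ V ∎))
      where
      open ≈-Reasoning
      V = prodWhere (divides? m) Φ[_p]Φ m'
      V-unit : IsUnit (V 0)
      V-unit = prodWhere-unit (divides? m) Φ[_p]Φ m'
        (λ e → IsUnit-* (cyclo (e ℕ.* p) 0) (cyclo e 0) (cyclo-unit (e ℕ.* p)) (cyclo-unit e))
      m∣m : divides? m m ≡ true
      m∣m = dec-true (m ∣? m) ∣-refl
      ih-divisors : ∀ e → 0 < e → e ≤ m' → divides? m e ≡ true → Φ[ e p]Φ ≈ dilate (cyclo e)
      ih-divisors e _ e≤m' e∣m =
        ih (s≤s e≤m') (λ (d∣p , d∣e) → p⊥m (d∣p , ∣-trans d∣e (does≡true⇒ (e ∣? m) e∣m)))

  cyclo-mul-p≈ : ∀ m' → let m = suc m' in Coprime p m →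
    cyclo (m ℕ.* p) ≈ negS (mulS (dilate (cyclo m)) (eCoeff m))
  cyclo-mul-p≈ m' p⊥m = begin
    cyclo (m ℕ.* p)
      ≈⟨ ≈-sym (mulS-identityʳ _) ⟩
    mulS (cyclo (m ℕ.* p)) oneS
      ≈⟨ mulS-congˡ (cyclo (m ℕ.* p)) (≈-sym (invS-inverseʳ Φ (cyclo-unit m))) ⟩
    mulS (cyclo (m ℕ.* p)) (mulS Φ (invS Φ))
      ≈⟨ ≈-sym (mulS-assoc (cyclo (m ℕ.* p)) Φ (invS Φ)) ⟩
    mulS (mulS (cyclo (m ℕ.* p)) Φ) (invS Φ)
      ≈⟨ mulS-congʳ (invS Φ) (cyclo-mul-dilate m p⊥m) ⟩
    mulS (dilate Φ) (invS Φ)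
      ≈⟨ mulS-congˡ (dilate Φ) (≈-trans (≈-sym (negS-involutive (invS Φ)))
                                        (negS-cong (≈-sym (eCoeff≈neg-invS-cyclo m')))) ⟩
    mulS (dilate Φ) (negS (eCoeff m))
      ≈⟨ mulS-negʳ (dilate Φ) (eCoeff m) ⟩
    negS (mulS (dilate Φ) (eCoeff m)) ∎
    where
    open ≈-Reasoning
    m = suc m'
    Φ = cyclo m

  fBlock2-formula : ∀ m' → let m = suc m' in Coprime p m → ∀ i j k → j ≤ p / m →
    fBlock2 m p i j k ≡ - sumTo i (λ s → cyclo m s * gBlock m p (i ∸ s) j k)
  fBlock2-formula m' p⊥m i j k j≤q with k <? blockLength (suc m') p j
  ... | yes k<len = begin
    fBlock2 m p i j k
      ≡⟨ fBlock2-blockLength m p i k j≤q ⟩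
    (if does (k <? blockLength m p j) then cyclo (m ℕ.* p) (i ℕ.* p ℕ.+ t) else + 0)
      ≡⟨ if-yes (k <? blockLength m p j) k<len ⟩
    cyclo (m ℕ.* p) (i ℕ.* p ℕ.+ t)
      ≡⟨ coeff (cyclo-mul-p≈ m' p⊥m) (i ℕ.* p ℕ.+ t) ⟩
    - mulS (dilate (cyclo m)) (eCoeff m) (i ℕ.* p ℕ.+ t)
      ≡⟨ cong -_ (mulS-dilate-coeff (cyclo m) (eCoeff m) i t t<p) ⟩
    - sumTo i (λ s → cyclo m s * eCoeff m ((i ∸ s) ℕ.* p ℕ.+ t))
      ≡⟨ cong -_ (sumTo-cong i (λ s _ → cong (cyclo m s *_) (sym (gBlock-inside (i ∸ s))))) ⟩
    - sumTo i (λ s → cyclo m s * gBlock m p (i ∸ s) j k) ∎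
    where
    open ≡-Reasoning
    m = suc m'
    t = j ℕ.* m ℕ.+ k
    t<p : t < p
    t<p = proj₂ (<-blockLength⇒ m p j≤q k<len)
    gBlock-inside : ∀ a → gBlock m p a j k ≡ eCoeff m (a ℕ.* p ℕ.+ t)
    gBlock-inside a = trans (if-yes (k <? blockLength m p j) k<len)
      (cong (eCoeff m) (trans (ℕ.+-assoc (a ℕ.* p) (m ℕ.* j) k)
                              (cong (λ z → a ℕ.* p ℕ.+ (z ℕ.+ k)) (ℕ.*-comm m j))))
  ... | no  k≮len =
    trans (trans (fBlock2-blockLength m p i k j≤q) (if-no (k <? blockLength m p j) k≮len))
    (sym (cong -_ (sumTo-zero i _ (λ s _ →
      trans (cong (cyclo m s *_) (if-no (k <? blockLength m p j) k≮len)) (ℤ.*-zeroʳ (cyclo m s))))))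
    where m = suc m'

mainTheorem7 : (m p : ℕ) → {{_ : NonZero m}} → m % 2 ≡ 1 → SquareFree m → Prime p → Coprime p m →
    ∀ i j → i < totient m → j ≤ p / m →
    ∀ k → fBlock2 m p i j k ≡ - sumTo i (λ s → cyclo m s * gBlock m p (i ∸ s) j k)
mainTheorem7 zero     p        {{m≢0}} _ _ _       _   _ _ _ _   _ = ⊥-elim (ℕ.≢-nonZero⁻¹ 0 {{m≢0}} refl)
mainTheorem7 (suc m') zero     _ _ p-prime _   _ _ _ _   _ = ⊥-elim (¬prime[0] p-prime)
mainTheorem7 (suc m') (suc p') _ _ p-prime p⊥m i j _ j≤q k =
  CycloDilation.fBlock2-formula p' p-prime m' p⊥m i j k j≤q
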